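{- Let $T[1,n]$ be a string and let $\mathcal{G}(T)$ be the weighted directed acyclic graph with vertices $v_1,\dots,v_{n+1}$ and an edge $(v_i,v_j)$ for every $1\le i<j\le n+1$, of cost $c(v_i,v_j)=|\mathcal{C}(T[i,j-1])|$, where the compressed size satisfies the monotonicity assumption stated in the context. Let $d_{\mathcal{G}(T)}(u,v)$ denote the shortest-path distance from $u$ to $v$ in $\mathcal{G}(T)$ (with $d(v,v)=0$). Then for every triple of indices $1\le i\le j\le q\le n+1$: (1) $d_{\mathcal{G}(T)}(v_j,v_q)\le d_{\mathcal{G}(T)}(v_i,v_q)$, and (2) $d_{\mathcal{G}(T)}(v_i,v_j)\le d_{\mathcal{G}(T)}(v_i,v_q)$.
   Context: $\mathcal{C}$ is a base compressor producing prefix-free encodings, and $|\mathcal{C}(\alpha)|$ denotes the length in bits of the compressed form of a string $\alpha$. The paper assumes the edge costs are positive and monotone: $0<c(v_i,v_{i+1})\le c(v_i,v_{i+2})\le\dots\le c(v_i,v_{n+1})$ for every $i$, and, more generally, the compressed size of a substring of $T$ is never larger than that of any substring of $T$ containing it (i.e. $|\mathcal{C}(T[a,b])|\le|\mathcal{C}(T[a',b'])|$ whenever $a'\le a\le b\le b'$). -}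

module Defs where

open import Data.Nat using (ℕ; zero; suc; _+_; _∸_; _≤_; _<_)
open import Data.Bool using (Bool)
open import Data.List using (List; length; take; drop)
open import Data.List.Relation.Binary.Prefix.Heterogeneous using (Prefix)
open import Data.Product using (Σ; _×_)
open import Relation.Binary.PropositionalEquality using (_≡_)
open import Relation.Nullary using (¬_)

-- Indices are 0-based and substrings half-open:
-- vertex v_{k+1} of the paper is vertex k here (k = 0 .. n, n = length T),
-- and  slice T i j  is the paper's T[i+1, j] (positions i .. j-1, 0-based).
slice : {A : Set} → List A → ℕ → ℕ → List A
slice T i j = take (j ∸ i) (drop i T)

Compressor : Set → Set
Compressor A = List A → List Bool

PrefixFree : {A : Set} → Compressor A → Set
PrefixFree {A} C = (α β : List A) → ¬ (α ≡ β) → ¬ Prefix _≡_ (C α) (C β)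

PositiveCosts : {A : Set} → Compressor A → List A → Set
PositiveCosts C T = (a b : ℕ) → a < b → b ≤ length T → 0 < length (C (slice T a b))

-- Monotonicity: a substring never compresses larger than a substring containing it.
-- (paper: a' ≤ a ≤ b ≤ b', 1-based closed; here a' ≤ a < b ≤ b' ≤ n, half-open)
MonotoneCosts : {A : Set} → Compressor A → List A → Set
MonotoneCosts C T = (a' a b b' : ℕ) → a' ≤ a → a < b → b ≤ b' → b' ≤ length T →
  length (C (slice T a b)) ≤ length (C (slice T a' b'))

edgeCost : {A : Set} → Compressor A → List A → ℕ → ℕ → ℕ
edgeCost C T i j = length (C (slice T i j))

-- Directed paths in G(T) from vertex i to vertex q: sequences of edges (i,j) with i < j.
-- (All vertices lie in [i, q], so they are vertices of G(T) whenever q ≤ n.)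
infixr 5 _∷_
data Path : ℕ → ℕ → Set where
  []  : ∀ {i} → Path i i
  _∷_ : ∀ {i j q} → i < j → Path j q → Path i q

pathCost : {A : Set} → Compressor A → List A → ∀ {i q} → Path i q → ℕ
pathCost C T []             = 0
pathCost C T (_∷_ {i} {j} _ p) = edgeCost C T i j + pathCost C T p

IsDist : {A : Set} → Compressor A → List A → ℕ → ℕ → ℕ → Set
IsDist C T i q d = Σ (Path i q) (λ p → pathCost C T p ≡ d) × ((p : Path i q) → d ≤ pathCost C T p)

-- Any path from i to q crosses position j along some edge (k , l) with k ≤ j < l. Cutting the
-- path there and replacing that edge by (j , l), resp. (k , j), gives a path from j to q,
-- resp. from i to j. By monotonicity the new edge is no dearer than the old one, and dropping
-- edges cannot raise a cost in ℕ, so neither cut path costs more than the original.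
module Submission where

open import Defs
open import Data.Nat using (ℕ; _≤_; _<_; _+_; z≤n)
open import Data.Nat.Properties
open import Data.List using (List; length)
open import Data.Product using (Σ; _×_; _,_)
open import Relation.Binary.PropositionalEquality using (refl; subst)
open import Relation.Nullary using (yes; no)

path⇒≤ : ∀ {i q} → Path i q → i ≤ q
path⇒≤ []        = ≤-refl
path⇒≤ (i<k ∷ p) = ≤-trans (<⇒≤ i<k) (path⇒≤ p)

module _ {A : Set} (C : Compressor A) (T : List A) where

  PathWithin : ℕ → ℕ → ℕ → Set
  PathWithin i q c = Σ (Path i q) (λ p → pathCost C T p ≤ c)

  dist≤pathWithin : ∀ {i q d c} → IsDist C T i q d → PathWithin i q c → d ≤ c
  dist≤pathWithin (_ , shortest) (p , p≤c) = ≤-trans (shortest p) p≤c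

  module _ (mono : MonotoneCosts C T) where

    pathWithin-from : ∀ {i q} j → i ≤ j → j ≤ q → q ≤ length T →
                      (p : Path i q) → PathWithin j q (pathCost C T p)
    pathWithin-from j i≤j j≤q q≤n [] with ≤-antisym i≤j j≤q
    ... | refl = [] , ≤-refl
    pathWithin-from {i} j i≤j j≤q q≤n (_∷_ {j = k} i<k p) with k ≤? j
    ... | yes k≤j = let (p′ , p′≤p) = pathWithin-from j k≤j j≤q q≤n p
                    in  p′ , ≤-trans p′≤p (m≤n+m _ _)
    ... | no  k≰j = j<k ∷ p , +-monoˡ-≤ (pathCost C T p) edge-jk≤edge-ik
      where
      j<k : j < k
      j<k = ≰⇒> k≰j
      edge-jk≤edge-ik : edgeCost C T j k ≤ edgeCost C T i k
      edge-jk≤edge-ik = mono i j k k i≤j j<k ≤-refl (≤-trans (path⇒≤ p) q≤n)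

    pathWithin-to : ∀ {i q} j → i ≤ j → j ≤ q → q ≤ length T →
                    (p : Path i q) → PathWithin i j (pathCost C T p)
    pathWithin-to j i≤j j≤q q≤n [] with ≤-antisym i≤j j≤q
    ... | refl = [] , ≤-refl
    pathWithin-to {i} j i≤j j≤q q≤n (_∷_ {j = k} i<k p) with i ≟ j | k ≤? j
    ... | yes refl | _       = [] , z≤n
    ... | no  _    | yes k≤j = let (p′ , p′≤p) = pathWithin-to j k≤j j≤q q≤n p
                               in  i<k ∷ p′ , +-monoʳ-≤ (edgeCost C T i k) p′≤p
    ... | no  i≢j  | no  k≰j = i<j ∷ [] , edge-ij≤path
      where
      i<j : i < j
      i<j = ≤∧≢⇒< i≤j i≢j
      edge-ij≤path : edgeCost C T i j + 0 ≤ edgeCost C T i k + pathCost C T p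
      edge-ij≤path = begin
        edgeCost C T i j + 0  ≡⟨ +-identityʳ _ ⟩
        edgeCost C T i j      ≤⟨ mono i i j k ≤-refl i<j (<⇒≤ (≰⇒> k≰j)) (≤-trans (path⇒≤ p) q≤n) ⟩
        edgeCost C T i k      ≤⟨ m≤m+n _ _ ⟩
        edgeCost C T i k + pathCost C T p ∎
        where open ≤-Reasoning

lemma1 : {A : Set} (T : List A) (C : Compressor A) →
    PrefixFree C → PositiveCosts C T → MonotoneCosts C T →
    (i j q : ℕ) → i ≤ j → j ≤ q → q ≤ length T →
    (dij djq diq : ℕ) → IsDist C T i j dij → IsDist C T j q djq → IsDist C T i q diq →
    (djq ≤ diq) × (dij ≤ diq)
lemma1 T C _ _ mono i j q i≤j j≤q q≤n dij djq diq dist-ij dist-jq ((p , p≡diq) , _) =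
  dist≤pathWithin C T dist-jq (subst (PathWithin C T j q) p≡diq from-j) ,
  dist≤pathWithin C T dist-ij (subst (PathWithin C T i j) p≡diq to-j)
  where
  from-j : PathWithin C T j q (pathCost C T p)
  from-j = pathWithin-from C T mono j i≤j j≤q q≤n p
  to-j : PathWithin C T i j (pathCost C T p)
  to-j = pathWithin-to C T mono j i≤j j≤q q≤n p
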